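{- For a permutation $\pi$ of $[m]$ let $H(\pi)=\sum_{t=1}^{m-1}\min\{\pi_t,\pi_{t+1}\}$ (with $H=0$ for $m\le1$). Let $i,j\ge0$ with $i+j=n-1$, let $\alpha\in\mathrm{Av}_i(213)$, $\beta\in\mathrm{Av}_j(213)$, and let $\pi=(\alpha+j+1)\,1\,(\beta+1)\in\mathrm{Av}_n(213)$. Then \[ H(\pi)=H(\alpha)+H(\beta)+\mathbf{1}_{\{i\ge2\}}(i-1)(j+1)+\mathbf{1}_{\{j\ge2\}}(j-1)+\mathbf{1}_{\{i\ge1\}}+\mathbf{1}_{\{j\ge1\}}. \]
   Context: $\mathrm{Av}_m(213)$ is the set of permutations $\gamma$ of $[m]$ with no $p<q<r$ such that $\gamma_q<\gamma_p<\gamma_r$. For a word $\alpha$ and integer $t$, $\alpha+t$ denotes the word obtained by adding $t$ to each entry; juxtaposition denotes concatenation. $\mathbf{1}_{\{A\}}$ is the indicator of $A$. -}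

module Defs where

open import Data.Nat using (ℕ; zero; suc; _+_; _*_; _∸_; _<_; _≤_; _⊓_)
open import Data.List using (List; []; _∷_; map; upTo; length; lookup; _++_; [_])
open import Data.List.Relation.Binary.Permutation.Propositional using (_↭_)
open import Data.Fin using (Fin) renaming (_<_ to _<ᶠ_)
open import Data.Product using (_×_)
open import Relation.Nullary using (¬_)
open import Relation.Nullary.Decidable using (⌊_⌋)
open import Data.Nat using (_≤?_)
open import Data.Bool using (if_then_else_)

oneTo : ℕ → List ℕ
oneTo m = map suc (upTo m)

-- w is a permutation of [m] in one-line notation
IsPerm : ℕ → List ℕ → Set
IsPerm m w = w ↭ oneTo m

Avoids213 : List ℕ → Set
Avoids213 w = (p q r : Fin (length w)) → p <ᶠ q → q <ᶠ r →
  ¬ ((lookup w q < lookup w p) × (lookup w p < lookup w r))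

Av213 : ℕ → List ℕ → Set
Av213 m w = IsPerm m w × Avoids213 w

H : List ℕ → ℕ
H [] = 0
H (x ∷ []) = 0
H (x ∷ y ∷ w) = (x ⊓ y) + H (y ∷ w)

shift : ℕ → List ℕ → List ℕ
shift t w = map (_+ t) w

𝟙≥ : ℕ → ℕ → ℕ
𝟙≥ k i = if ⌊ k ≤? i ⌋ then 1 else 0

-- Shifting a word by t raises each of its (length − 1) adjacent minima by t, so
-- H(α + j + 1) = H(α) + (i − 1)(j + 1) and H(β + 1) = H(β) + (j − 1). The entry 1
-- is smaller than both of its neighbours, so each of the two adjacencies around it
-- contributes exactly 1 when that side is nonempty. The indicator 𝟙{i ≥ 2} only
-- records that (i ∸ 1) vanishes for i ≤ 1.
module Submission where

open import Defs
open import Data.Nat using (ℕ; zero; suc; _+_; _*_; _∸_; _≤_; _⊓_)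
open import Data.Nat.Properties
  using (+-assoc; +-identityʳ; *-identityʳ; +-distribʳ-⊓; ⊓-comm; m≥n⇒m⊓n≡n; m≤n+m; ≤-trans; ≤-refl)
open import Data.Nat.Tactic.RingSolver using (solve-∀)
open import Data.List using (List; []; _∷_; _++_; [_]; length; map; upTo)
open import Data.List.Properties using (length-map; length-upTo)
open import Data.List.Relation.Binary.Permutation.Propositional.Properties using (↭-length)
open import Data.Product using (_,_)
open import Relation.Binary.PropositionalEquality
  using (_≡_; refl; sym; trans; cong; cong₂; module ≡-Reasoning)

length-perm : ∀ {m w} → IsPerm m w → length w ≡ m
length-perm {m} w↭ = trans (↭-length w↭) (trans (length-map suc (upTo m)) (length-upTo m))

H-shift : ∀ t w → H (shift t w) ≡ H w + (length w ∸ 1) * t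
H-shift t [] = refl
H-shift t (x ∷ []) = refl
H-shift t (x ∷ y ∷ w) = begin
  (x + t) ⊓ (y + t) + H (shift t (y ∷ w))     ≡⟨ cong₂ _+_ (sym (+-distribʳ-⊓ t x y)) (H-shift t (y ∷ w)) ⟩
  (x ⊓ y + t) + (H (y ∷ w) + length w * t)    ≡⟨ rearrange (x ⊓ y) t (H (y ∷ w)) (length w * t) ⟩
  x ⊓ y + H (y ∷ w) + (t + length w * t)      ∎
  where
  open ≡-Reasoning
  rearrange : ∀ a t b c → (a + t) + (b + c) ≡ a + b + (t + c)
  rearrange = solve-∀

H-++-∷ : ∀ xs z ys → H (xs ++ z ∷ ys) ≡ H (xs ++ [ z ]) + H (z ∷ ys)
H-++-∷ [] z ys = refl
H-++-∷ (x ∷ []) z ys = cong (_+ H (z ∷ ys)) (sym (+-identityʳ (x ⊓ z)))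
H-++-∷ (x ∷ y ∷ xs) z ys =
  trans (cong (x ⊓ y +_) (H-++-∷ (y ∷ xs) z ys)) (sym (+-assoc (x ⊓ y) _ _))

shift⊓1 : ∀ {t} → 1 ≤ t → ∀ x → (x + t) ⊓ 1 ≡ 1
shift⊓1 {t} 1≤t x = m≥n⇒m⊓n≡n (≤-trans 1≤t (m≤n+m t x))

H-shift-∷ʳ-1 : ∀ {t} → 1 ≤ t → ∀ xs → H (shift t xs ++ [ 1 ]) ≡ H (shift t xs) + 𝟙≥ 1 (length xs)
H-shift-∷ʳ-1 1≤t [] = refl
H-shift-∷ʳ-1 1≤t (x ∷ []) = cong (_+ 0) (shift⊓1 1≤t x)
H-shift-∷ʳ-1 {t} 1≤t (x ∷ y ∷ xs) =
  trans (cong ((x + t) ⊓ (y + t) +_) (H-shift-∷ʳ-1 1≤t (y ∷ xs))) (sym (+-assoc ((x + t) ⊓ (y + t)) _ 1))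

H-1-∷-shift : ∀ {t} → 1 ≤ t → ∀ ys → H (1 ∷ shift t ys) ≡ 𝟙≥ 1 (length ys) + H (shift t ys)
H-1-∷-shift 1≤t [] = refl
H-1-∷-shift {t} 1≤t (y ∷ ys) = cong (_+ H (shift t (y ∷ ys))) (trans (⊓-comm 1 (y + t)) (shift⊓1 1≤t y))

𝟙≥2-absorbs-pred : ∀ n c → 𝟙≥ 2 n * ((n ∸ 1) * c) ≡ (n ∸ 1) * c
𝟙≥2-absorbs-pred zero c = refl
𝟙≥2-absorbs-pred (suc zero) c = refl
𝟙≥2-absorbs-pred (suc (suc n)) c = +-identityʳ _

H-around-1 : ∀ α β → H (shift (length β + 1) α ++ 1 ∷ shift 1 β)
  ≡ H α + H β + 𝟙≥ 2 (length α) * ((length α ∸ 1) * (length β + 1)) + 𝟙≥ 2 (length β) * (length β ∸ 1)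
    + 𝟙≥ 1 (length α) + 𝟙≥ 1 (length β)
H-around-1 α β = begin
  H (shift (b + 1) α ++ 1 ∷ shift 1 β)
    ≡⟨ H-++-∷ (shift (b + 1) α) 1 (shift 1 β) ⟩
  H (shift (b + 1) α ++ [ 1 ]) + H (1 ∷ shift 1 β)
    ≡⟨ cong₂ _+_ (H-shift-∷ʳ-1 (m≤n+m 1 b) α) (H-1-∷-shift ≤-refl β) ⟩
  (H (shift (b + 1) α) + 𝟙≥ 1 a) + (𝟙≥ 1 b + H (shift 1 β))
    ≡⟨ cong₂ (λ x y → (x + 𝟙≥ 1 a) + (𝟙≥ 1 b + y)) (H-shift (b + 1) α) (H-shift 1 β) ⟩
  (H α + (a ∸ 1) * (b + 1) + 𝟙≥ 1 a) + (𝟙≥ 1 b + (H β + (b ∸ 1) * 1))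
    ≡⟨ regroup (H α) (H β) ((a ∸ 1) * (b + 1)) ((b ∸ 1) * 1) (𝟙≥ 1 a) (𝟙≥ 1 b) ⟩
  H α + H β + (a ∸ 1) * (b + 1) + (b ∸ 1) * 1 + 𝟙≥ 1 a + 𝟙≥ 1 b
    ≡⟨ cong₂ (λ x y → H α + H β + x + y + 𝟙≥ 1 a + 𝟙≥ 1 b)
         (sym (𝟙≥2-absorbs-pred a (b + 1)))
         (trans (sym (𝟙≥2-absorbs-pred b 1)) (cong (𝟙≥ 2 b *_) (*-identityʳ (b ∸ 1)))) ⟩
  H α + H β + 𝟙≥ 2 a * ((a ∸ 1) * (b + 1)) + 𝟙≥ 2 b * (b ∸ 1) + 𝟙≥ 1 a + 𝟙≥ 1 b
    ∎
  where
  open ≡-Reasoning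
  a = length α
  b = length β
  regroup : ∀ A B P Q I J → (A + P + I) + (J + (B + Q)) ≡ A + B + P + Q + I + J
  regroup = solve-∀

lemma4p1 : (i j : ℕ) (α β : List ℕ) → Av213 i α → Av213 j β →
    H (shift (j + 1) α ++ (1 ∷ shift 1 β))
      ≡ H α + H β + 𝟙≥ 2 i * ((i ∸ 1) * (j + 1)) + 𝟙≥ 2 j * (j ∸ 1)
        + 𝟙≥ 1 i + 𝟙≥ 1 j
lemma4p1 i j α β (α-perm , _) (β-perm , _)
  with refl ← length-perm α-perm | refl ← length-perm β-perm = H-around-1 α β
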